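{- For all positive integers $a,b,c$, $|\mathrm{PP}(a,b,c)|=|\mathrm{BM}(a,b,c)|$.
   Context: $\mathrm{PP}(a,b,c)$ is the set of plane partitions (arrays $(\pi_{ij})_{i,j\ge1}$ of nonnegative integers, finitely many nonzero, weakly decreasing along rows and columns) with at most $b$ nonzero rows, at most $a$ nonzero columns, and all entries at most $c$. $\mathrm{BM}(a,b,c)$ is the set of $b\times c$ matrices $D=(d_{i\ell})$ with nonnegative integer entries such that $\max_\Pi\sum_{(i,\ell)\in\Pi}d_{i\ell}\le a$, where the maximum is over monotone lattice paths $\Pi$ from $(1,1)$ to $(b,c)$ with steps $(i,\ell)\to(i+1,\ell)$ and $(i,\ell)\to(i,\ell+1)$. -}

module Defs where

open import Data.Nat using (ℕ; zero; suc; _+_; _≤_; _≥_; _⊔_)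
open import Data.List using (List; []; _∷_; _++_; foldr)
import Data.List as List
open import Data.Vec using (Vec; []; _∷_; head; tail)
import Data.Vec as Vec
open import Data.Vec.Relation.Unary.All using (All)
open import Data.Vec.Relation.Binary.Pointwise.Inductive using (Pointwise)
open import Data.Product using (Σ; _×_)

Matrix : ℕ → ℕ → Set
Matrix rows cols = Vec (Vec ℕ cols) rows

data Chain {A : Set} (R : A → A → Set) : {n : ℕ} → Vec A n → Set where
  []  : Chain R []
  [-] : ∀ {x} → Chain R (x ∷ [])
  _∷_ : ∀ {n x y} {xs : Vec A n} → R x y → Chain R (y ∷ xs) → Chain R (x ∷ y ∷ xs)

-- Plane partitions with at most b nonzero rows, at most a nonzero columns
-- and entries ≤ c, represented by their b × a corner (all other entries are 0).
PP : ℕ → ℕ → ℕ → Set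
PP a b c = Σ (Matrix b a) λ π →
    All (Chain _≥_) π
  × Chain (Pointwise _≥_) π
  × All (All (_≤ c)) π

-- The list of sums Σ_{(i,ℓ)∈Π} d_{iℓ} over all monotone lattice paths Π from
-- the top-left entry (1,1) to the bottom-right entry (rows,cols), using steps
-- down (i+1,ℓ) and right (i,ℓ+1).
pathSums : (rows cols : ℕ) → Matrix rows cols → List ℕ
pathSums zero    cols    m  = []
pathSums (suc r) zero    m  = []
pathSums (suc r) (suc k) (row ∷ rs) with pathSums r (suc k) rs ++ pathSums (suc r) k (Vec.map tail (row ∷ rs))
... | []       = head row ∷ []
... | s ∷ ss   = List.map (head row +_) (s ∷ ss)

maxPathSum : (rows cols : ℕ) → Matrix rows cols → ℕ
maxPathSum rows cols d = foldr _⊔_ 0 (pathSums rows cols d)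

BM : ℕ → ℕ → ℕ → Set
BM a b c = Σ (Matrix b c) λ d → maxPathSum b c d ≤ a

-- Conjugating every row of a plane partition, each row being a
-- partition with at most a parts of size at most c, exchanges the roles of a and c;
-- the columns stay weakly decreasing because conjugation is monotone.  Then a
-- plane partition π with b rows, c columns and entries ≤ a determines a b × c
-- matrix D by  π(i,ℓ) = d(i,ℓ) + max(π(i+1,ℓ), π(i,ℓ+1)),  so that π(i,ℓ) is the
-- maximal path sum of D from (i,ℓ) to (b,c).  Hence π(1,1) ≤ a is exactly the
-- condition defining BM(a,b,c).
module Submission where

open import Defs
open import Data.Nat using (ℕ; _≤_)
open import Function.Bundles using (_↔_)

open import Data.Nat using (zero; suc; _+_; _∸_; _⊔_; _≥_; pred; z≤n; s≤s)
open import Data.Nat.Properties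
open import Data.List using (List; []; _∷_; _++_; foldr)
import Data.List as List
open import Data.Vec using (Vec; []; _∷_; head; tail; replicate)
import Data.Vec as Vec
open import Data.Vec.Relation.Unary.All using (All; []; _∷_)
import Data.Vec.Relation.Unary.All as All
open import Data.Vec.Relation.Unary.All.Properties using (map⁺)
open import Data.Vec.Relation.Binary.Pointwise.Inductive using (Pointwise; []; _∷_)
open import Data.Product using (Σ; _×_; _,_)
open import Function.Bundles using (mk↔ₛ′)
open import Function.Properties.Inverse using (↔-trans)
open import Relation.Binary.PropositionalEquality
import Relation.Binary.Definitions as Binary
import Relation.Unary as Unary
open import Relation.Nullary using (Irrelevant)

private
  variable
    A B : Set
    k m n r : ℕ

Chain-irrelevant : {R : A → A → Set} → Binary.Irrelevant R → Unary.Irrelevant (Chain R {n})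
Chain-irrelevant irr []       []       = refl
Chain-irrelevant irr [-]      [-]      = refl
Chain-irrelevant irr (p ∷ ps) (q ∷ qs) = cong₂ _∷_ (irr p q) (Chain-irrelevant irr ps qs)

Pointwise-irrelevant : {R : A → B → Set} → Binary.Irrelevant R →
                       Binary.Irrelevant (Pointwise R {m} {n})
Pointwise-irrelevant irr []       []       = refl
Pointwise-irrelevant irr (p ∷ ps) (q ∷ qs) = cong₂ _∷_ (irr p q) (Pointwise-irrelevant irr ps qs)

×-irrelevant : Irrelevant A → Irrelevant B → Irrelevant (A × B)
×-irrelevant irrA irrB (a , b) (a′ , b′) = cong₂ _,_ (irrA a a′) (irrB b b′)

IsPlanePartition : ℕ → Matrix r k → Set
IsPlanePartition c π = All (Chain _≥_) π × Chain (Pointwise _≥_) π × All (All (_≤ c)) π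

IsPlanePartition-irrelevant : ∀ c → Unary.Irrelevant (IsPlanePartition {r} {k} c)
IsPlanePartition-irrelevant c =
  ×-irrelevant (All.irrelevant (Chain-irrelevant ≤-irrelevant))
    (×-irrelevant (Chain-irrelevant (Pointwise-irrelevant ≤-irrelevant))
                  (All.irrelevant (All.irrelevant ≤-irrelevant)))

,-≡-irrelevant : {P : A → Set} → Unary.Irrelevant P →
                 ∀ {x y} {p : P x} {q : P y} → x ≡ y → (x , p) ≡ (y , q)
,-≡-irrelevant irr refl = cong (_ ,_) (irr _ _)

Σ-irrelevant-↔ : {P : A → Set} {Q : B → Set} → Unary.Irrelevant P → Unary.Irrelevant Q →
  (f : A → B) (g : B → A) → (∀ {x} → P x → Q (f x)) → (∀ {y} → Q y → P (g y)) →
  (∀ {y} → Q y → f (g y) ≡ y) → (∀ {x} → P x → g (f x) ≡ x) → Σ A P ↔ Σ B Q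
Σ-irrelevant-↔ irrP irrQ f g f-pres g-pres f∘g g∘f = mk↔ₛ′
  (λ (x , p) → f x , f-pres p) (λ (y , q) → g y , g-pres q)
  (λ (y , q) → ,-≡-irrelevant irrQ (f∘g q)) (λ (x , p) → ,-≡-irrelevant irrP (g∘f p))

Chain-tail : {R : A → A → Set} {x : A} {xs : Vec A n} → Chain R (x ∷ xs) → Chain R xs
Chain-tail [-]      = []
Chain-tail (_ ∷ ch) = ch

Chain-map : {R : A → A → Set} {S : B → B → Set} {f : A → B} →
            (∀ {x y} → R x y → S (f x) (f y)) → {v : Vec A n} → Chain R v → Chain S (Vec.map f v)
Chain-map f-mono []       = []
Chain-map f-mono [-]      = [-]
Chain-map f-mono (p ∷ ch) = f-mono p ∷ Chain-map f-mono ch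

decreasing⇒All≤head : ∀ {x} {xs : Vec ℕ n} → Chain _≥_ (x ∷ xs) → All (_≤ x) xs
decreasing⇒All≤head [-]      = []
decreasing⇒All≤head (p ∷ ch) = p ∷ All.map (λ q → ≤-trans q p) (decreasing⇒All≤head ch)

-- Conjugation of the rows

#nonzero : Vec ℕ n → ℕ
#nonzero []          = 0
#nonzero (zero  ∷ v) = #nonzero v
#nonzero (suc _ ∷ v) = suc (#nonzero v)

-- Entry j (from 0) counts the entries of v exceeding j: for a weakly decreasing v
-- with entries ≤ c this is the conjugate partition, padded with zeros to length c.
conjugate : (c : ℕ) → Vec ℕ n → Vec ℕ c
conjugate zero    v = []
conjugate (suc c) v = #nonzero v ∷ conjugate c (Vec.map pred v)

#nonzero-mono : {v w : Vec ℕ n} → Pointwise _≥_ v w → #nonzero w ≤ #nonzero v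
#nonzero-mono [] = z≤n
#nonzero-mono {v = zero  ∷ _} {zero  ∷ _} (_ ∷ p) = #nonzero-mono p
#nonzero-mono {v = suc _ ∷ _} {zero  ∷ _} (_ ∷ p) = m≤n⇒m≤1+n (#nonzero-mono p)
#nonzero-mono {v = suc _ ∷ _} {suc _ ∷ _} (_ ∷ p) = s≤s (#nonzero-mono p)

#nonzero-≤-length : (v : Vec ℕ n) → #nonzero v ≤ n
#nonzero-≤-length []          = z≤n
#nonzero-≤-length (zero  ∷ v) = m≤n⇒m≤1+n (#nonzero-≤-length v)
#nonzero-≤-length (suc _ ∷ v) = s≤s (#nonzero-≤-length v)

#nonzero-zeros : {v : Vec ℕ n} → All (_≤ 0) v → #nonzero v ≡ 0
#nonzero-zeros []        = refl
#nonzero-zeros (z≤n ∷ p) = #nonzero-zeros p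

map-pred-mono : {v w : Vec ℕ n} → Pointwise _≥_ v w →
                Pointwise _≥_ (Vec.map pred v) (Vec.map pred w)
map-pred-mono []      = []
map-pred-mono (p ∷ ps) = pred-mono-≤ p ∷ map-pred-mono ps

map-pred-≤ : (v : Vec ℕ n) → Pointwise _≥_ v (Vec.map pred v)
map-pred-≤ []      = []
map-pred-≤ (_ ∷ v) = pred[n]≤n ∷ map-pred-≤ v

map-pred-All≤ : ∀ {x} {v : Vec ℕ n} → All (_≤ x) v → All (_≤ pred x) (Vec.map pred v)
map-pred-All≤ []       = []
map-pred-All≤ (p ∷ ps) = pred-mono-≤ p ∷ map-pred-All≤ ps

conjugate-mono : ∀ c {v w : Vec ℕ n} → Pointwise _≥_ v w →
                 Pointwise _≥_ (conjugate c v) (conjugate c w)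
conjugate-mono zero    p = []
conjugate-mono (suc c) p = #nonzero-mono p ∷ conjugate-mono c (map-pred-mono p)

conjugate-decreasing : ∀ c (v : Vec ℕ n) → Chain _≥_ (conjugate c v)
conjugate-decreasing zero          v = []
conjugate-decreasing (suc zero)    v = [-]
conjugate-decreasing (suc (suc c)) v =
  #nonzero-mono (map-pred-≤ v) ∷ conjugate-decreasing (suc c) (Vec.map pred v)

conjugate-bounded : ∀ c (v : Vec ℕ n) → All (_≤ n) (conjugate c v)
conjugate-bounded zero    v = []
conjugate-bounded (suc c) v = #nonzero-≤-length v ∷ conjugate-bounded c (Vec.map pred v)

#nonzero-conjugate-zeros : ∀ c {v : Vec ℕ n} → All (_≤ 0) v → #nonzero (conjugate c v) ≡ 0
#nonzero-conjugate-zeros zero    p = refl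
#nonzero-conjugate-zeros (suc c) p
  rewrite #nonzero-zeros p = #nonzero-conjugate-zeros c (map-pred-All≤ p)

#nonzero-conjugate-cons : ∀ c x (xs : Vec ℕ n) → x ≤ c → All (_≤ x) xs →
                          #nonzero (conjugate c (x ∷ xs)) ≡ x
#nonzero-conjugate-cons zero    zero    xs z≤n p = refl
#nonzero-conjugate-cons (suc c) zero    xs _   p
  rewrite #nonzero-zeros p = #nonzero-conjugate-zeros c (z≤n ∷ map-pred-All≤ p)
#nonzero-conjugate-cons (suc c) (suc x) xs (s≤s x≤c) p =
  cong suc (#nonzero-conjugate-cons c x (Vec.map pred xs) x≤c (map-pred-All≤ p))

-- Removing a largest part x lowers the first x columns by one.
map-pred-conjugate-cons : ∀ c x (xs : Vec ℕ n) → All (_≤ x) xs →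
                          Vec.map pred (conjugate c (x ∷ xs)) ≡ conjugate c xs
map-pred-conjugate-cons zero    x       xs p = refl
map-pred-conjugate-cons (suc c) zero    xs p rewrite #nonzero-zeros p =
  cong (0 ∷_) (map-pred-conjugate-cons c zero (Vec.map pred xs) (map-pred-All≤ p))
map-pred-conjugate-cons (suc c) (suc x) xs p =
  cong (#nonzero xs ∷_) (map-pred-conjugate-cons c x (Vec.map pred xs) (map-pred-All≤ p))

conjugate-involutive : ∀ c (v : Vec ℕ n) → Chain _≥_ v → All (_≤ c) v →
                       conjugate n (conjugate c v) ≡ v
conjugate-involutive c []       _  _        = refl
conjugate-involutive c (x ∷ xs) ch (x≤c ∷ bd) = cong₂ _∷_
  (#nonzero-conjugate-cons c x xs x≤c xs≤x)
  (trans (cong (conjugate _) (map-pred-conjugate-cons c x xs xs≤x))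
         (conjugate-involutive c xs (Chain-tail ch) bd))
  where xs≤x = decreasing⇒All≤head ch

map-conjugate-involutive : ∀ c (π : Matrix r n) → All (Chain _≥_) π → All (All (_≤ c)) π →
                           Vec.map (conjugate n) (Vec.map (conjugate c) π) ≡ π
map-conjugate-involutive c []      _          _          = refl
map-conjugate-involutive c (v ∷ π) (ch ∷ chs) (bd ∷ bds) =
  cong₂ _∷_ (conjugate-involutive c v ch bd) (map-conjugate-involutive c π chs bds)

conjugate-isPlanePartition : ∀ c {π : Matrix r n} → IsPlanePartition c π →
                             IsPlanePartition n (Vec.map (conjugate c) π)
conjugate-isPlanePartition c {π} (_ , columns , _) =
  map⁺ (All.universal (conjugate-decreasing c) π) ,
  Chain-map (conjugate-mono c) columns ,
  map⁺ (All.universal (conjugate-bounded c) π)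

PP-conjugate : ∀ a b c → PP a b c ↔ PP c b a
PP-conjugate a b c = Σ-irrelevant-↔
  (IsPlanePartition-irrelevant c) (IsPlanePartition-irrelevant a)
  (Vec.map (conjugate c)) (Vec.map (conjugate a))
  (conjugate-isPlanePartition c) (conjugate-isPlanePartition a)
  (λ (rows , _ , bounded) → map-conjugate-involutive a _ rows bounded)
  (λ (rows , _ , bounded) → map-conjugate-involutive c _ rows bounded)

-- The maximal path sums of a matrix

head₀ : Vec ℕ n → ℕ
head₀ []      = 0
head₀ (x ∷ _) = x

corner : Matrix r k → ℕ
corner []        = 0
corner (row ∷ _) = head₀ row

topRow : Matrix r k → Vec ℕ k
topRow []        = replicate _ 0
topRow (row ∷ _) = row

-- m is the row of maximal path sums below the row d of D.
maxPathRow : Vec ℕ k → Vec ℕ k → Vec ℕ k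
maxPathRow []       m = []
maxPathRow (d ∷ ds) m = d + (head m ⊔ head₀ (maxPathRow ds (tail m))) ∷ maxPathRow ds (tail m)

differenceRow : Vec ℕ k → Vec ℕ k → Vec ℕ k
differenceRow []       m = []
differenceRow (v ∷ vs) m = v ∸ (head m ⊔ head₀ vs) ∷ differenceRow vs (tail m)

maxPathMatrix : Matrix r k → Matrix r k
maxPathMatrix []         = []
maxPathMatrix (row ∷ rs) = maxPathRow row (topRow (maxPathMatrix rs)) ∷ maxPathMatrix rs

differenceMatrix : Matrix r k → Matrix r k
differenceMatrix []         = []
differenceMatrix (row ∷ rs) = differenceRow row (topRow rs) ∷ differenceMatrix rs

head₀≤head : ∀ {x} {xs : Vec ℕ n} → Chain _≥_ (x ∷ xs) → head₀ xs ≤ x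
head₀≤head [-]     = z≤n
head₀≤head (p ∷ _) = p

differenceRow-maxPathRow : (d m : Vec ℕ k) → differenceRow (maxPathRow d m) m ≡ d
differenceRow-maxPathRow []       []       = refl
differenceRow-maxPathRow (d ∷ ds) (m ∷ ms) =
  cong₂ _∷_ (m+n∸n≡m d (m ⊔ head₀ (maxPathRow ds ms))) (differenceRow-maxPathRow ds ms)

maxPathRow-differenceRow : (v m : Vec ℕ k) → Chain _≥_ v → Pointwise _≥_ v m →
                           maxPathRow (differenceRow v m) m ≡ v
maxPathRow-differenceRow []       []       _  _        = refl
maxPathRow-differenceRow (v ∷ vs) (m ∷ ms) ch (m≤v ∷ p)
  rewrite maxPathRow-differenceRow vs ms (Chain-tail ch) p =
  cong (_∷ vs) (m∸n+n≡m (⊔-lub m≤v (head₀≤head ch)))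

maxPathRow-decreasing : (d m : Vec ℕ k) → Chain _≥_ (maxPathRow d m)
maxPathRow-decreasing []           []           = []
maxPathRow-decreasing (d ∷ [])     (m ∷ [])     = [-]
maxPathRow-decreasing (d ∷ d′ ∷ ds) (m ∷ m′ ∷ ms) =
  ≤-trans (m≤n⊔m m _) (m≤n+m _ d) ∷ maxPathRow-decreasing (d′ ∷ ds) (m′ ∷ ms)

maxPathRow-≥ : (d m : Vec ℕ k) → Pointwise _≥_ (maxPathRow d m) m
maxPathRow-≥ []       []       = []
maxPathRow-≥ (d ∷ ds) (m ∷ ms) = ≤-trans (m≤m⊔n m _) (m≤n+m _ d) ∷ maxPathRow-≥ ds ms

maxPathMatrix-rows : (D : Matrix r k) → All (Chain _≥_) (maxPathMatrix D)
maxPathMatrix-rows []         = []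
maxPathMatrix-rows (row ∷ rs) = maxPathRow-decreasing row _ ∷ maxPathMatrix-rows rs

maxPathMatrix-columns : (D : Matrix r k) → Chain (Pointwise _≥_) (maxPathMatrix D)
maxPathMatrix-columns []              = []
maxPathMatrix-columns (row ∷ [])      = [-]
maxPathMatrix-columns (row ∷ r′ ∷ rs) = maxPathRow-≥ row _ ∷ maxPathMatrix-columns (r′ ∷ rs)

differenceMatrix-maxPathMatrix : (D : Matrix r k) → differenceMatrix (maxPathMatrix D) ≡ D
differenceMatrix-maxPathMatrix []         = refl
differenceMatrix-maxPathMatrix (row ∷ rs) =
  cong₂ _∷_ (differenceRow-maxPathRow row _) (differenceMatrix-maxPathMatrix rs)

≥-replicate-0 : (v : Vec ℕ k) → Pointwise _≥_ v (replicate k 0)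
≥-replicate-0 []      = []
≥-replicate-0 (_ ∷ v) = z≤n ∷ ≥-replicate-0 v

≥-topRow : ∀ {v : Vec ℕ k} {vs : Matrix r k} → Chain (Pointwise _≥_) (v ∷ vs) →
           Pointwise _≥_ v (topRow vs)
≥-topRow {v = v} [-] = ≥-replicate-0 v
≥-topRow (p ∷ _)     = p

maxPathMatrix-differenceMatrix : (M : Matrix r k) → All (Chain _≥_) M → Chain (Pointwise _≥_) M →
                                 maxPathMatrix (differenceMatrix M) ≡ M
maxPathMatrix-differenceMatrix []       _          _ = refl
maxPathMatrix-differenceMatrix (v ∷ vs) (ch ∷ chs) columns
  rewrite maxPathMatrix-differenceMatrix vs chs (Chain-tail columns) =
  cong (_∷ vs) (maxPathRow-differenceRow v (topRow vs) ch (≥-topRow columns))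

topRow-map-tail : (M : Matrix r (suc k)) → topRow (Vec.map tail M) ≡ tail (topRow M)
topRow-map-tail []      = refl
topRow-map-tail (_ ∷ _) = refl

maxPathMatrix-map-tail : (D : Matrix r (suc k)) →
                         maxPathMatrix (Vec.map tail D) ≡ Vec.map tail (maxPathMatrix D)
maxPathMatrix-map-tail []                = refl
maxPathMatrix-map-tail ((d ∷ ds) ∷ rs)
  rewrite maxPathMatrix-map-tail rs | topRow-map-tail (maxPathMatrix rs) = refl

head-topRow : (M : Matrix r (suc k)) → head (topRow M) ≡ corner M
head-topRow []              = refl
head-topRow ((x ∷ _) ∷ _)   = refl

foldr-⊔-++ : (xs ys : List ℕ) → foldr _⊔_ 0 (xs ++ ys) ≡ foldr _⊔_ 0 xs ⊔ foldr _⊔_ 0 ys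
foldr-⊔-++ []       ys = refl
foldr-⊔-++ (x ∷ xs) ys = trans (cong (x ⊔_) (foldr-⊔-++ xs ys)) (sym (⊔-assoc x _ _))

-- The list must be nonempty: the empty maximum is 0, not h.
foldr-⊔-map-+ : ∀ h s (l : List ℕ) →
                foldr _⊔_ 0 (List.map (h +_) (s ∷ l)) ≡ h + foldr _⊔_ 0 (s ∷ l)
foldr-⊔-map-+ h s []      = trans (⊔-identityʳ (h + s)) (cong (h +_) (sym (⊔-identityʳ s)))
foldr-⊔-map-+ h s (t ∷ l) =
  trans (cong ((h + s) ⊔_) (foldr-⊔-map-+ h t l)) (sym (+-distribˡ-⊔ h s _))

maxPathSum-cons : ∀ r k (row : Vec ℕ (suc k)) (rs : Matrix r (suc k)) →
  maxPathSum (suc r) (suc k) (row ∷ rs) ≡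
  head row + foldr _⊔_ 0 (pathSums r (suc k) rs ++ pathSums (suc r) k (Vec.map tail (row ∷ rs)))
maxPathSum-cons r k row rs
  with pathSums r (suc k) rs ++ pathSums (suc r) k (Vec.map tail (row ∷ rs))
... | []     = trans (⊔-identityʳ (head row)) (sym (+-identityʳ (head row)))
... | s ∷ ss = foldr-⊔-map-+ (head row) s ss

maxPathSum≡corner : ∀ r k (D : Matrix r k) → maxPathSum r k D ≡ corner (maxPathMatrix D)
maxPathSum≡corner zero    k       []              = refl
maxPathSum≡corner (suc r) zero    ([] ∷ rs)       = refl
maxPathSum≡corner (suc r) (suc k) ((d ∷ ds) ∷ rs) = begin
  maxPathSum (suc r) (suc k) ((d ∷ ds) ∷ rs)
    ≡⟨ maxPathSum-cons r k (d ∷ ds) rs ⟩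
  d + foldr _⊔_ 0 (pathSums r (suc k) rs ++ pathSums (suc r) k (ds ∷ Vec.map tail rs))
    ≡⟨ cong (d +_) (foldr-⊔-++ (pathSums r (suc k) rs) _) ⟩
  d + (maxPathSum r (suc k) rs ⊔ maxPathSum (suc r) k (ds ∷ Vec.map tail rs))
    ≡⟨ cong₂ (λ u w → d + (u ⊔ w)) (maxPathSum≡corner r (suc k) rs)
                                    (maxPathSum≡corner (suc r) k (ds ∷ Vec.map tail rs)) ⟩
  d + (corner (maxPathMatrix rs) ⊔ head₀ (maxPathRow ds (topRow (maxPathMatrix (Vec.map tail rs)))))
    ≡⟨ cong₂ (λ u w → d + (u ⊔ head₀ (maxPathRow ds w)))
             (sym (head-topRow (maxPathMatrix rs)))
             (trans (cong topRow (maxPathMatrix-map-tail rs))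
                    (topRow-map-tail (maxPathMatrix rs))) ⟩
  corner (maxPathMatrix ((d ∷ ds) ∷ rs)) ∎
  where open ≡-Reasoning

decreasing⇒All≤head₀ : {v : Vec ℕ k} → Chain _≥_ v → All (_≤ head₀ v) v
decreasing⇒All≤head₀ []                 = []
decreasing⇒All≤head₀ {v = x ∷ _} ch = ≤-refl ∷ decreasing⇒All≤head ch

Pointwise-≥-All≤ : ∀ {t} {u v : Vec ℕ k} → Pointwise _≥_ u v → All (_≤ t) u → All (_≤ t) v
Pointwise-≥-All≤ []       []       = []
Pointwise-≥-All≤ (p ∷ ps) (q ∷ qs) = ≤-trans p q ∷ Pointwise-≥-All≤ ps qs

decreasingColumns-All≤ : ∀ {t} {row : Vec ℕ k} {rs : Matrix r k} →
  Chain (Pointwise _≥_) (row ∷ rs) → All (_≤ t) row → All (All (_≤ t)) (row ∷ rs)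
decreasingColumns-All≤ [-]      bd = bd ∷ []
decreasingColumns-All≤ (p ∷ ch) bd = bd ∷ decreasingColumns-All≤ ch (Pointwise-≥-All≤ p bd)

All≤corner : (M : Matrix r k) → All (Chain _≥_) M → Chain (Pointwise _≥_) M →
             All (All (_≤ corner M)) M
All≤corner []         _        _       = []
All≤corner (row ∷ rs) (ch ∷ _) columns = decreasingColumns-All≤ columns (decreasing⇒All≤head₀ ch)

corner-≤ : ∀ {a} (M : Matrix r k) → All (All (_≤ a)) M → corner M ≤ a
corner-≤ []              _              = z≤n
corner-≤ ([] ∷ _)        _              = z≤n
corner-≤ ((x ∷ _) ∷ _)   ((x≤a ∷ _) ∷ _) = x≤a

PP↔BM : ∀ a b c → PP c b a ↔ BM a b c
PP↔BM a b c = Σ-irrelevant-↔ (IsPlanePartition-irrelevant a) ≤-irrelevant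
  differenceMatrix maxPathMatrix maxPathSum-differenceMatrix-≤ maxPathMatrix-isPlanePartition
  (λ _ → differenceMatrix-maxPathMatrix _)
  (λ (rows , columns , _) → maxPathMatrix-differenceMatrix _ rows columns)
  where
  maxPathSum-differenceMatrix-≤ : {M : Matrix b c} → IsPlanePartition a M →
                                  maxPathSum b c (differenceMatrix M) ≤ a
  maxPathSum-differenceMatrix-≤ {M} (rows , columns , bounded) = begin
    maxPathSum b c (differenceMatrix M)
      ≡⟨ maxPathSum≡corner b c _ ⟩
    corner (maxPathMatrix (differenceMatrix M))
      ≡⟨ cong corner (maxPathMatrix-differenceMatrix M rows columns) ⟩
    corner M
      ≤⟨ corner-≤ M bounded ⟩
    a ∎
    where open ≤-Reasoning

  maxPathMatrix-isPlanePartition : {D : Matrix b c} → maxPathSum b c D ≤ a →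
                                   IsPlanePartition a (maxPathMatrix D)
  maxPathMatrix-isPlanePartition {D} D≤a =
    rows , columns ,
    All.map (All.map (λ x≤corner → ≤-trans x≤corner corner≤a))
            (All≤corner (maxPathMatrix D) rows columns)
    where
    rows    = maxPathMatrix-rows D
    columns = maxPathMatrix-columns D
    corner≤a = subst (_≤ a) (maxPathSum≡corner b c D) D≤a

corollary2p4 : (a b c : ℕ) → 1 ≤ a → 1 ≤ b → 1 ≤ c → PP a b c ↔ BM a b c
corollary2p4 a b c _ _ _ = ↔-trans (PP-conjugate a b c) (PP↔BM a b c)
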